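{- Let $n\ge 2$ be even, let $p_1,\dots,p_l$ be distinct primes each of which is a $\varphi$-divisor of $n$ of degree $k_i$ (with $p_i^{k_i}\ge 3$), let $2\le m\le\min(p_1^{k_1}-1,\dots,p_l^{k_l}-1)$, let $c=p_1^{n_1}\cdots p_l^{n_l}$ with natural $n_1,\dots,n_l$, and let $b$ be a nonnegative integer. Then the equation $\sum_{i=1}^m x_i^n=bc^n$ has no solution with all $x_i\in\mathbb{N}$ if and only if the equation $\sum_{i=1}^m x_i^n=b$ has no solution with all $x_i\in\mathbb{N}$.
   Context: $\varphi$ is Euler's totient function. For an even natural number $n$, a prime $q$ is a $\varphi$-divisor of $n$ if there is a natural $k$ with $q^k\ge3$ and $\varphi(q^k)\mid n$; the largest such $k$ is its degree. $\mathbb{N}=\{1,2,\dots\}$. -}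

module Defs where

open import Data.Nat using (ℕ; zero; suc; _+_; _*_; _^_; _≤_; _<_; _≥_)
open import Data.Nat.GCD using (gcd)
open import Data.Nat.Divisibility using (_∣_)
open import Data.Nat.Primality using (Prime)
import Data.Fin
open Data.Fin using (Fin)
open import Data.List using (List; length; filter; upTo; map)
open import Data.Product using (_×_)
open import Relation.Nullary using (¬_)
open import Relation.Binary.PropositionalEquality using (_≡_)
open import Data.Nat using (_≟_)

φ : ℕ → ℕ
φ n = length (filter (λ j → gcd j n ≟ 1) (map suc (upTo n)))

IsφDivisorExp : ℕ → ℕ → ℕ → Set
IsφDivisorExp n q k = 1 ≤ k × q ^ k ≥ 3 × φ (q ^ k) ∣ n

IsφDivisorOfDegree : ℕ → ℕ → ℕ → Set
IsφDivisorOfDegree n q k =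
  Prime q × IsφDivisorExp n q k × (∀ j → k < j → ¬ IsφDivisorExp n q j)

sumFin : (m : ℕ) → (Fin m → ℕ) → ℕ
sumFin zero f = 0
sumFin (suc m) f = f Data.Fin.zero + sumFin m (λ i → f (Data.Fin.suc i))

prodFin : (m : ℕ) → (Fin m → ℕ) → ℕ
prodFin zero f = 1
prodFin (suc m) f = f Data.Fin.zero * prodFin m (λ i → f (Data.Fin.suc i))

HasSolution : (m n t : ℕ) → Set
HasSolution m n t = Data.Product.Σ (Fin m → ℕ) λ x → (∀ i → 1 ≤ x i) × sumFin m (λ i → x i ^ n) ≡ t

-- Multiplying a solution of  Σ xᵢⁿ = b  by c solves  Σ xᵢⁿ = b cⁿ.  Conversely let p be one of the
-- pᵢ, with φ(pᵏ) ∣ n.  By Euler's theorem xⁿ ≡ 1 (mod pᵏ) when p ∤ x, while pᵏ ∣ xⁿ when p ∣ x,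
-- since k ≤ φ(pᵏ) ≤ n.  Reducing a solution of  Σ xᵢⁿ = t pⁿ  modulo pᵏ, the number of xᵢ prime
-- to p is ≡ 0 and at most m < pᵏ, hence zero: p divides every xᵢ, and dividing by p solves
-- Σ yᵢⁿ = t.  Repeating this for every prime factor of c descends from b cⁿ to b.
module Submission where

open import Defs
import Algebra.Properties.CommutativeMonoid.Sum as CommutativeMonoidSum
open import Data.Empty using (⊥-elim)
open import Data.Fin using (Fin; toℕ; fromℕ<)
import Data.Fin as Fin
open import Data.Fin.Permutation using (Permutation; permutation; _⟨$⟩ʳ_)
open import Data.Fin.Properties using (toℕ-injective; toℕ-fromℕ<; toℕ<n)
open import Data.List using (length; filter; map; upTo; applyUpTo)
open import Data.List.Properties using (map-applyUpTo; filter-accept; filter-reject; filter-≐)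
open import Data.Nat
open import Data.Nat.Coprimality as Coprimality using (Coprime; coprime?; coprime-divisor; coprime-Bézout)
open import Data.Nat.Divisibility
open import Data.Nat.DivMod
open import Data.Nat.GCD using (gcd; module Bézout)
open import Data.Nat.Primality using (Prime; prime⇒irreducible; prime⇒nonZero; prime⇒nonTrivial)
open import Data.Nat.Properties
open import Algebra.Properties.CommutativeSemigroup *-commutativeSemigroup
  using () renaming (interchange to *-interchange)
open import Data.Nat.Solver using (module +-*-Solver)
open import Data.Product using (∃; _,_; proj₁; proj₂)
open import Data.Sum using (inj₁; inj₂)
open import Function.Base using (_∘_; id)
open import Function.Bundles using (_⇔_; mk⇔)
open import Function.Definitions using (Injective)
open import Relation.Nullary using (¬_; Dec; yes; no; ¬?; contradiction)
open import Relation.Nullary.Decidable using (decidable-stable)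
open import Relation.Binary.PropositionalEquality
open import Relation.Unary using (_≐_)
open +-*-Solver

^-distribʳ-* : ∀ m n o → (m * n) ^ o ≡ m ^ o * n ^ o
^-distribʳ-* m n zero    = refl
^-distribʳ-* m n (suc o) = begin
  m * n * (m * n) ^ o      ≡⟨ cong (m * n *_) (^-distribʳ-* m n o) ⟩
  m * n * (m ^ o * n ^ o)  ≡⟨ *-interchange m n (m ^ o) (n ^ o) ⟩
  m * m ^ o * (n * n ^ o)  ∎
  where open ≡-Reasoning

^-monoˡ-∣ : ∀ {m n} o → m ∣ n → m ^ o ∣ n ^ o
^-monoˡ-∣ zero    m∣n = ∣-refl
^-monoˡ-∣ (suc o) m∣n = *-pres-∣ m∣n (^-monoˡ-∣ o m∣n)

^-monoʳ-∣ : ∀ m {n o} → n ≤ o → m ^ n ∣ m ^ o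
^-monoʳ-∣ m {n} {o} n≤o = divides (m ^ (o ∸ n)) (begin
  m ^ o                ≡⟨ cong (m ^_) (m+[n∸m]≡n n≤o) ⟨
  m ^ (n + (o ∸ n))    ≡⟨ ^-distribˡ-+-* m n (o ∸ n) ⟩
  m ^ n * m ^ (o ∸ n)  ≡⟨ *-comm (m ^ n) _ ⟩
  m ^ (o ∸ n) * m ^ n  ∎)
  where open ≡-Reasoning

n<m^n : ∀ {m} → 2 ≤ m → ∀ n → n < m ^ n
n<m^n 2≤m zero    = z<s
n<m^n {m} 2≤m (suc n) = begin
  1 + suc n        ≤⟨ +-mono-≤ (≤-trans (s≤s z≤n) IH) IH ⟩
  m ^ n + m ^ n    ≡⟨ cong (m ^ n +_) (+-identityʳ (m ^ n)) ⟨
  2 * m ^ n        ≤⟨ *-monoˡ-≤ (m ^ n) 2≤m ⟩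
  m * m ^ n        ∎
  where
  open ≤-Reasoning
  IH : n < m ^ n
  IH = n<m^n 2≤m n

sumFin-cong : ∀ m {f g : Fin m → ℕ} → (∀ i → f i ≡ g i) → sumFin m f ≡ sumFin m g
sumFin-cong zero    f≗g = refl
sumFin-cong (suc m) f≗g = cong₂ _+_ (f≗g Fin.zero) (sumFin-cong m (f≗g ∘ Fin.suc))

prodFin-cong : ∀ m {f g : Fin m → ℕ} → (∀ i → f i ≡ g i) → prodFin m f ≡ prodFin m g
prodFin-cong zero    f≗g = refl
prodFin-cong (suc m) f≗g = cong₂ _*_ (f≗g Fin.zero) (prodFin-cong m (f≗g ∘ Fin.suc))

sumFin-*ʳ : ∀ m (f : Fin m → ℕ) c → sumFin m (λ i → f i * c) ≡ sumFin m f * c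
sumFin-*ʳ zero    f c = refl
sumFin-*ʳ (suc m) f c = trans (cong (f Fin.zero * c +_) (sumFin-*ʳ m (f ∘ Fin.suc) c))
                              (sym (*-distribʳ-+ c (f Fin.zero) _))

prodFin-* : ∀ m (f g : Fin m → ℕ) → prodFin m (λ i → f i * g i) ≡ prodFin m f * prodFin m g
prodFin-* zero    f g = refl
prodFin-* (suc m) f g = trans (cong (f Fin.zero * g Fin.zero *_) (prodFin-* m (f ∘ Fin.suc) (g ∘ Fin.suc)))
                              (*-interchange (f Fin.zero) (g Fin.zero) _ _)

prodFin-^ : ∀ m x (f : Fin m → ℕ) → prodFin m (λ i → x ^ f i) ≡ x ^ sumFin m f
prodFin-^ zero    x f = refl
prodFin-^ (suc m) x f = trans (cong (x ^ f Fin.zero *_) (prodFin-^ m x (f ∘ Fin.suc)))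
                              (sym (^-distribˡ-+-* x (f Fin.zero) _))

prodFin-positive : ∀ m {f : Fin m → ℕ} → (∀ i → 0 < f i) → 0 < prodFin m f
prodFin-positive zero    f>0 = z<s
prodFin-positive (suc m) f>0 = *-mono-≤ (f>0 Fin.zero) (prodFin-positive m (f>0 ∘ Fin.suc))

prodFin-permute : ∀ n (f : Fin n → ℕ) (π : Permutation n n) → prodFin n f ≡ prodFin n (f ∘ (π ⟨$⟩ʳ_))
prodFin-permute n f π = begin
  prodFin n f                   ≡⟨ prodFin≡∏ n f ⟩
  ∏ f                           ≡⟨ ∏-permute f π ⟩
  ∏ (f ∘ (π ⟨$⟩ʳ_))             ≡⟨ prodFin≡∏ n (f ∘ (π ⟨$⟩ʳ_)) ⟨
  prodFin n (f ∘ (π ⟨$⟩ʳ_))     ∎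
  where
  open ≡-Reasoning
  open CommutativeMonoidSum *-1-commutativeMonoid using () renaming (sum to ∏; ∑-permute to ∏-permute)
  prodFin≡∏ : ∀ m (g : Fin m → ℕ) → prodFin m g ≡ ∏ g
  prodFin≡∏ zero    g = refl
  prodFin≡∏ (suc m) g = cong (g Fin.zero *_) (prodFin≡∏ m (g ∘ Fin.suc))

indicator : {P : Set} → Dec P → ℕ
indicator (yes _) = 1
indicator (no _)  = 0

indicator≤1 : ∀ {P : Set} (P? : Dec P) → indicator P? ≤ 1
indicator≤1 (yes _) = ≤-refl
indicator≤1 (no _)  = z≤n

indicator-yes : ∀ {P : Set} (P? : Dec P) → P → indicator P? ≡ 1
indicator-yes (yes _) _  = refl
indicator-yes (no ¬P) Pv = contradiction Pv ¬P

indicator-no : ∀ {P : Set} (P? : Dec P) → ¬ P → indicator P? ≡ 0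
indicator-no (yes Pv) ¬P = contradiction Pv ¬P
indicator-no (no _)   _  = refl

sumFin-indicator≤ : ∀ m {P : Fin m → Set} (P? : ∀ i → Dec (P i)) → sumFin m (λ i → indicator (P? i)) ≤ m
sumFin-indicator≤ zero    P? = z≤n
sumFin-indicator≤ (suc m) P? = +-mono-≤ (indicator≤1 (P? Fin.zero)) (sumFin-indicator≤ m (P? ∘ Fin.suc))

sumFin-indicator≡0 : ∀ m {P : Fin m → Set} (P? : ∀ i → Dec (P i)) →
                     sumFin m (λ i → indicator (P? i)) ≡ 0 → ∀ i → ¬ P i
sumFin-indicator≡0 (suc m) P? sum≡0 Fin.zero with P? Fin.zero
... | no ¬P = ¬P
sumFin-indicator≡0 (suc m) P? sum≡0 (Fin.suc i) =
  sumFin-indicator≡0 m (P? ∘ Fin.suc) (m+n≡0⇒n≡0 (indicator (P? Fin.zero)) sum≡0) i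

sumBelow : ℕ → (ℕ → ℕ) → ℕ
sumBelow n g = sumFin n (g ∘ toℕ)

sumBelow-suc : ∀ n g → sumBelow (suc n) g ≡ sumBelow n g + g n
sumBelow-suc zero    g = +-comm (g 0) 0
sumBelow-suc (suc n) g = begin
  g 0 + sumBelow (suc n) (g ∘ suc)          ≡⟨ cong (g 0 +_) (sumBelow-suc n (g ∘ suc)) ⟩
  g 0 + (sumBelow n (g ∘ suc) + g (suc n))  ≡⟨ +-assoc (g 0) _ _ ⟨
  g 0 + sumBelow n (g ∘ suc) + g (suc n)    ∎
  where open ≡-Reasoning

sumBelow-mono : ∀ {m n} g → m ≤ n → sumBelow m g ≤ sumBelow n g
sumBelow-mono g z≤n       = z≤n
sumBelow-mono g (s≤s m≤n) = +-monoʳ-≤ (g 0) (sumBelow-mono (g ∘ suc) m≤n)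

length-filter≡sumBelow : ∀ {P : ℕ → Set} (P? : ∀ v → Dec (P v)) f n →
                         length (filter P? (applyUpTo f n)) ≡ sumBelow n (λ v → indicator (P? (f v)))
length-filter≡sumBelow P? f zero    = refl
length-filter≡sumBelow {P} P? f (suc n) = by-cases (P? (f 0))
  where
  by-cases : (P?f0 : Dec (P (f 0))) → length (filter P? (applyUpTo f (suc n))) ≡
             indicator P?f0 + sumBelow n (λ v → indicator (P? (f (suc v))))
  by-cases (yes Pf0) = trans (cong length (filter-accept P? Pf0)) (cong suc (length-filter≡sumBelow P? (f ∘ suc) n))
  by-cases (no ¬Pf0) = trans (cong length (filter-reject P? ¬Pf0)) (length-filter≡sumBelow P? (f ∘ suc) n)

coprime-* : ∀ {a b n} → Coprime a n → Coprime b n → Coprime (a * b) n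
coprime-* {a} {b} {n} a⊥n b⊥n {d} (d∣ab , d∣n) = b⊥n (coprime-divisor d⊥a d∣ab , d∣n)
  where
  d⊥a : Coprime d a
  d⊥a (e∣d , e∣a) = a⊥n (e∣a , ∣-trans e∣d d∣n)

coprime-*⁻ʳ : ∀ {a b n} → Coprime (a * b) n → Coprime b n
coprime-*⁻ʳ {a} ab⊥n (d∣b , d∣n) = ab⊥n (∣n⇒∣m*n a d∣b , d∣n)

coprime-^ʳ : ∀ {a n} k → Coprime a n → Coprime a (n ^ k)
coprime-^ʳ {a} {n} k a⊥n = Coprimality.sym (n^k⊥a k)
  where
  n^k⊥a : ∀ k → Coprime (n ^ k) a
  n^k⊥a zero    = Coprimality.1-coprimeTo a
  n^k⊥a (suc k) = coprime-* (Coprimality.sym a⊥n) (n^k⊥a k)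

prodFin-coprime : ∀ m {n} {f : Fin m → ℕ} → (∀ i → Coprime (f i) n) → Coprime (prodFin m f) n
prodFin-coprime zero    {n} f⊥n = Coprimality.1-coprimeTo n
prodFin-coprime (suc m)     f⊥n = coprime-* (f⊥n Fin.zero) (prodFin-coprime m (f⊥n ∘ Fin.suc))

¬∣⇒coprime : ∀ {p a} → Prime p → ¬ p ∣ a → Coprime a p
¬∣⇒coprime p-prime p∤a (d∣a , d∣p) with prime⇒irreducible p-prime d∣p
... | inj₁ d≡1  = d≡1
... | inj₂ refl = contradiction d∣a p∤a

module _ {N : ℕ} .{{_ : NonZero N}} where

  +-cong-mod : ∀ {a a′ b b′} → a % N ≡ a′ % N → b % N ≡ b′ % N → (a + b) % N ≡ (a′ + b′) % N
  +-cong-mod {a} {a′} {b} {b′} a≡a′ b≡b′ = begin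
    (a + b) % N                ≡⟨ %-distribˡ-+ a b N ⟩
    (a % N + b % N) % N        ≡⟨ cong₂ (λ u v → (u + v) % N) a≡a′ b≡b′ ⟩
    (a′ % N + b′ % N) % N      ≡⟨ %-distribˡ-+ a′ b′ N ⟨
    (a′ + b′) % N              ∎
    where open ≡-Reasoning

  *-cong-mod : ∀ {a a′ b b′} → a % N ≡ a′ % N → b % N ≡ b′ % N → (a * b) % N ≡ (a′ * b′) % N
  *-cong-mod {a} {a′} {b} {b′} a≡a′ b≡b′ = begin
    (a * b) % N                ≡⟨ %-distribˡ-* a b N ⟩
    (a % N * (b % N)) % N      ≡⟨ cong₂ (λ u v → (u * v) % N) a≡a′ b≡b′ ⟩
    (a′ % N * (b′ % N)) % N    ≡⟨ %-distribˡ-* a′ b′ N ⟨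
    (a′ * b′) % N              ∎
    where open ≡-Reasoning

  sumFin-cong-mod : ∀ m {f g : Fin m → ℕ} → (∀ i → f i % N ≡ g i % N) → sumFin m f % N ≡ sumFin m g % N
  sumFin-cong-mod zero    f≡g = refl
  sumFin-cong-mod (suc m) f≡g = +-cong-mod (f≡g Fin.zero) (sumFin-cong-mod m (f≡g ∘ Fin.suc))

  prodFin-cong-mod : ∀ m {f g : Fin m → ℕ} → (∀ i → f i % N ≡ g i % N) → prodFin m f % N ≡ prodFin m g % N
  prodFin-cong-mod zero    f≡g = refl
  prodFin-cong-mod (suc m) f≡g = *-cong-mod (f≡g Fin.zero) (prodFin-cong-mod m (f≡g ∘ Fin.suc))

  ^-cong-mod : ∀ {a b} q → a % N ≡ b % N → a ^ q % N ≡ b ^ q % N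
  ^-cong-mod zero    a≡b = refl
  ^-cong-mod (suc q) a≡b = *-cong-mod a≡b (^-cong-mod q a≡b)

  %≡%⇒∣∸ : ∀ a b → a % N ≡ b % N → N ∣ b ∸ a
  %≡%⇒∣∸ a b a≡b = divides (b / N ∸ a / N) (begin
    b ∸ a                                      ≡⟨ cong₂ _∸_ (m≡m%n+[m/n]*n b N) (m≡m%n+[m/n]*n a N) ⟩
    (b % N + b / N * N) ∸ (a % N + a / N * N)  ≡⟨ cong (λ r → (r + b / N * N) ∸ (a % N + a / N * N)) a≡b ⟨
    (a % N + b / N * N) ∸ (a % N + a / N * N)  ≡⟨ [m+n]∸[m+o]≡n∸o (a % N) (b / N * N) (a / N * N) ⟩
    b / N * N ∸ a / N * N                      ≡⟨ *-distribʳ-∸ N (b / N) (a / N) ⟨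
    (b / N ∸ a / N) * N                        ∎)
    where open ≡-Reasoning

  coprime-cancel-mod : ∀ {h a} → Coprime h N → 0 < a → h % N ≡ (a * h) % N → a % N ≡ 1 % N
  coprime-cancel-mod {h} {a} h⊥N a>0 h≡ah = begin
    a % N              ≡⟨ cong (_% N) (m+[n∸m]≡n a>0) ⟨
    (1 + (a ∸ 1)) % N  ≡⟨ %-remove-+ʳ 1 N∣a∸1 ⟩
    1 % N              ∎
    where
    open ≡-Reasoning
    ah∸h≡h[a∸1] : a * h ∸ h ≡ h * (a ∸ 1)
    ah∸h≡h[a∸1] = begin
      a * h ∸ h      ≡⟨ cong (a * h ∸_) (*-identityˡ h) ⟨
      a * h ∸ 1 * h  ≡⟨ *-distribʳ-∸ h a 1 ⟨
      (a ∸ 1) * h    ≡⟨ *-comm (a ∸ 1) h ⟩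
      h * (a ∸ 1)    ∎
    N∣a∸1 : N ∣ a ∸ 1
    N∣a∸1 = coprime-divisor (Coprimality.sym h⊥N) (subst (N ∣_) ah∸h≡h[a∸1] (%≡%⇒∣∸ h (a * h) h≡ah))

  coprime-% : ∀ {a} → Coprime a N → Coprime (a % N) N
  coprime-% a⊥N (d∣a%N , d∣N) = a⊥N (∣n∣m%n⇒∣m d∣N d∣a%N , d∣N)

  coprime-%⁻ : ∀ {a} → Coprime (a % N) N → Coprime a N
  coprime-%⁻ a%N⊥N (d∣a , d∣N) = a%N⊥N (%-presˡ-∣ d∣a d∣N , d∣N)

  coprime⇒invertible : ∀ {a} → Coprime a N → ∃ λ b → (b * a) % N ≡ 1 % N
  coprime⇒invertible {a} a⊥N with coprime-Bézout a⊥N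
  ... | Bézout.+- b c 1+cN≡ba = b , (begin
    (b * a) % N      ≡⟨ cong (_% N) 1+cN≡ba ⟨
    (1 + c * N) % N  ≡⟨ %-remove-+ʳ 1 (n∣m*n c) ⟩
    1 % N            ∎)
    where open ≡-Reasoning
  ... | Bézout.-+ b c 1+ba≡cN = M * b , (begin
    M * b * a % N                ≡⟨ %-remove-+ʳ (M * b * a) ∣-refl ⟨
    (M * b * a + N) % N          ≡⟨ cong (λ r → (M * b * a + r) % N) (m+[n∸m]≡n N>0) ⟨
    (M * b * a + (1 + M)) % N    ≡⟨ cong (_% N) (solve 3 (λ M b a → M :* b :* a :+ (con 1 :+ M)
                                                              := con 1 :+ M :* (con 1 :+ b :* a)) refl M b a) ⟩
    (1 + M * (1 + b * a)) % N    ≡⟨ cong (λ r → (1 + M * r) % N) 1+ba≡cN ⟩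
    (1 + M * (c * N)) % N        ≡⟨ %-remove-+ʳ 1 (∣n⇒∣m*n M (n∣m*n c)) ⟩
    1 % N                        ∎)
    where
    open ≡-Reasoning
    -- b * a ≡ -1 and M ≡ -1 (mod N), so M * b inverts a
    M : ℕ
    M = N ∸ 1
    N>0 : 0 < N
    N>0 = >-nonZero⁻¹ N

-- Euler's theorem

φ≡sumBelow : ∀ N → φ N ≡ sumBelow N (λ v → indicator (coprime? (suc v) N))
φ≡sumBelow N = begin
  φ N                                                ≡⟨ cong length (filter-≐ _ _ gcd≡1⇔coprime (map suc (upTo N))) ⟩
  length (filter coprimeTo? (map suc (upTo N)))      ≡⟨ cong (length ∘ filter coprimeTo?) (map-applyUpTo id suc N) ⟩
  length (filter coprimeTo? (applyUpTo suc N))       ≡⟨ length-filter≡sumBelow coprimeTo? suc N ⟩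
  sumBelow N (λ v → indicator (coprime? (suc v) N))  ∎
  where
  open ≡-Reasoning
  coprimeTo? : ∀ j → Dec (Coprime j N)
  coprimeTo? j = coprime? j N
  gcd≡1⇔coprime : (λ j → gcd j N ≡ 1) ≐ (λ j → Coprime j N)
  gcd≡1⇔coprime = Coprimality.gcd≡1⇒coprime , Coprimality.coprime⇒gcd≡1

-- Shifting the range 1..N of the definition to 0..N-1 is harmless, as neither 0 nor N is coprime to N.
φ≡sumBelow-coprime : ∀ {N} → 1 < N → φ N ≡ sumBelow N (λ v → indicator (coprime? v N))
φ≡sumBelow-coprime {N} 1<N = begin
  φ N                           ≡⟨ φ≡sumBelow N ⟩
  0 + sumBelow N (g ∘ suc)      ≡⟨ cong (_+ sumBelow N (g ∘ suc)) (indicator-no (coprime? 0 N) ¬0⊥N) ⟨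
  g 0 + sumBelow N (g ∘ suc)    ≡⟨ sumBelow-suc N g ⟩
  sumBelow N g + g N            ≡⟨ cong (sumBelow N g +_) (indicator-no (coprime? N N) ¬N⊥N) ⟩
  sumBelow N g + 0              ≡⟨ +-identityʳ _ ⟩
  sumBelow N g                  ∎
  where
  open ≡-Reasoning
  g : ℕ → ℕ
  g v = indicator (coprime? v N)
  ¬0⊥N : ¬ Coprime 0 N
  ¬0⊥N = Coprimality.¬0-coprimeTo-2+ {{n>1⇒nonTrivial 1<N}}
  ¬N⊥N : ¬ Coprime N N
  ¬N⊥N N⊥N = <⇒≢ 1<N (sym (N⊥N (∣-refl , ∣-refl)))

p^k≤φ[p^[1+k]] : ∀ {p} → Prime p → ∀ k → p ^ k ≤ φ (p ^ suc k)
p^k≤φ[p^[1+k]] {p} p-prime k = subst (p ^ k ≤_) (sym (φ≡sumBelow (p ^ suc k))) (units-below (p ^ k))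
  where
  g : ℕ → ℕ
  g v = indicator (coprime? (suc v) (p ^ suc k))
  p∤1+p*r : ∀ r → ¬ p ∣ suc (p * r)
  p∤1+p*r r p∣1+pr = nonTrivial⇒≢1 {{prime⇒nonTrivial p-prime}}
    (∣1⇒≡1 (∣m+n∣m⇒∣n (subst (p ∣_) (+-comm 1 (p * r)) p∣1+pr) (m∣m*n r)))
  -- the numbers 1 + p r with r < p ^ k are all coprime to p ^ (1 + k)
  units-below : ∀ r → r ≤ sumBelow (p * r) g
  units-below zero    = z≤n
  units-below (suc r) = begin
    suc r                           ≡⟨ +-comm 1 r ⟩
    r + 1                           ≤⟨ +-mono-≤ (units-below r) (≤-reflexive (sym g[pr]≡1)) ⟩
    sumBelow (p * r) g + g (p * r)  ≡⟨ sumBelow-suc (p * r) g ⟨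
    sumBelow (suc (p * r)) g        ≤⟨ sumBelow-mono g 1+pr≤p[1+r] ⟩
    sumBelow (p * suc r) g          ∎
    where
    open ≤-Reasoning
    g[pr]≡1 : g (p * r) ≡ 1
    g[pr]≡1 = indicator-yes (coprime? _ _) (coprime-^ʳ (suc k) (¬∣⇒coprime p-prime (p∤1+p*r r)))
    1+pr≤p[1+r] : suc (p * r) ≤ p * suc r
    1+pr≤p[1+r] = subst (suc (p * r) ≤_) (sym (*-suc p r))
                    (+-monoˡ-≤ (p * r) (>-nonZero⁻¹ p {{prime⇒nonZero p-prime}}))

k≤φ[p^k] : ∀ {p} → Prime p → ∀ k → k ≤ φ (p ^ k)
k≤φ[p^k] p-prime zero    = z≤n
k≤φ[p^k] p-prime (suc k) =
  ≤-trans (n<m^n (nonTrivial⇒n>1 _ {{prime⇒nonTrivial p-prime}}) k) (p^k≤φ[p^[1+k]] p-prime k)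

-- The product U of the units below N is a unit; multiplication by x permutes the residues and
-- multiplies each unit factor by x, so U ≡ x ^ #units * U and x ^ #units ≡ 1.
module UnitProduct {N x : ℕ} .{{_ : NonZero N}} (1<N : 1 < N) (x⊥N : Coprime x N) where

  multiplyBy : ℕ → Fin N → Fin N
  multiplyBy a j = fromℕ< (m%n<n (a * toℕ j) N)

  multiplyBy-inverse : ∀ a b → (b * a) % N ≡ 1 % N → ∀ j → multiplyBy b (multiplyBy a j) ≡ j
  multiplyBy-inverse a b ba≡1 j = toℕ-injective (begin
    toℕ (multiplyBy b (multiplyBy a j))  ≡⟨ toℕ-fromℕ< _ ⟩
    (b * toℕ (multiplyBy a j)) % N       ≡⟨ cong (λ r → (b * r) % N) (toℕ-fromℕ< _) ⟩
    (b * ((a * toℕ j) % N)) % N          ≡⟨ *-cong-mod {a = b} refl (m%n%n≡m%n (a * toℕ j) N) ⟩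
    (b * (a * toℕ j)) % N                ≡⟨ cong (_% N) (*-assoc b a (toℕ j)) ⟨
    (b * a * toℕ j) % N                  ≡⟨ *-cong-mod ba≡1 refl ⟩
    (1 * toℕ j) % N                      ≡⟨ cong (_% N) (*-identityˡ (toℕ j)) ⟩
    toℕ j % N                            ≡⟨ m<n⇒m%n≡m (toℕ<n j) ⟩
    toℕ j                                ∎)
    where open ≡-Reasoning

  x⁻¹ : ℕ
  x⁻¹ = proj₁ (coprime⇒invertible x⊥N)

  x⁻¹x≡1 : (x⁻¹ * x) % N ≡ 1 % N
  x⁻¹x≡1 = proj₂ (coprime⇒invertible x⊥N)

  ×x : Permutation N N
  ×x = permutation (multiplyBy x) (multiplyBy x⁻¹)
         (multiplyBy-inverse x⁻¹ x (trans (cong (_% N) (*-comm x x⁻¹)) x⁻¹x≡1))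
         (multiplyBy-inverse x x⁻¹ x⁻¹x≡1)

  unitPart : ∀ {j} → Dec (Coprime j N) → ℕ
  unitPart {j} (yes _) = j
  unitPart     (no _)  = 1

  unitPart-coprime : ∀ {j} (j⊥N? : Dec (Coprime j N)) → Coprime (unitPart j⊥N?) N
  unitPart-coprime (yes j⊥N) = j⊥N
  unitPart-coprime (no _)    = Coprimality.1-coprimeTo N

  unitPart-× : ∀ j (xj⊥N? : Dec (Coprime ((x * j) % N) N)) (j⊥N? : Dec (Coprime j N)) →
               unitPart xj⊥N? % N ≡ (x ^ indicator j⊥N? * unitPart j⊥N?) % N
  unitPart-× j (yes _)    (yes _)    =
    trans (m%n%n≡m%n (x * j) N) (cong (λ y → (y * j) % N) (sym (*-identityʳ x)))
  unitPart-× j (no ¬xj⊥N) (yes j⊥N)  = ⊥-elim (¬xj⊥N (coprime-% (coprime-* x⊥N j⊥N)))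
  unitPart-× j (yes xj⊥N) (no ¬j⊥N)  = ⊥-elim (¬j⊥N (coprime-*⁻ʳ {a = x} (coprime-%⁻ xj⊥N)))
  unitPart-× j (no _)     (no _)     = refl

  unit : ℕ → ℕ
  unit j = unitPart (coprime? j N)

  U #units : ℕ
  U = prodFin N (unit ∘ toℕ)
  #units = sumBelow N (λ v → indicator (coprime? v N))

  U≡x^#units*U : U % N ≡ (x ^ #units * U) % N
  U≡x^#units*U = begin
    U % N                                           ≡⟨ cong (_% N) (prodFin-permute N (unit ∘ toℕ) ×x) ⟩
    prodFin N (unit ∘ toℕ ∘ multiplyBy x) % N        ≡⟨ cong (_% N) (prodFin-cong N unit-×x) ⟩
    prodFin N (λ j → unit ((x * toℕ j) % N)) % N     ≡⟨ prodFin-cong-mod N unit-× ⟩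
    prodFin N (λ j → x ^ isUnit j * unit (toℕ j)) % N ≡⟨ cong (_% N) (prodFin-* N (λ j → x ^ isUnit j) _) ⟩
    (prodFin N (λ j → x ^ isUnit j) * U) % N         ≡⟨ cong (λ r → (r * U) % N) (prodFin-^ N x isUnit) ⟩
    (x ^ #units * U) % N                            ∎
    where
    open ≡-Reasoning
    isUnit : Fin N → ℕ
    isUnit j = indicator (coprime? (toℕ j) N)
    unit-×x : ∀ j → unit (toℕ (multiplyBy x j)) ≡ unit ((x * toℕ j) % N)
    unit-×x j = cong unit (toℕ-fromℕ< (m%n<n (x * toℕ j) N))
    unit-× : ∀ j → unit ((x * toℕ j) % N) % N ≡ (x ^ isUnit j * unit (toℕ j)) % N
    unit-× j = unitPart-× (toℕ j) (coprime? _ N) (coprime? (toℕ j) N)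

  x^#units≡1 : x ^ #units % N ≡ 1 % N
  x^#units≡1 = coprime-cancel-mod (prodFin-coprime N (λ j → unitPart-coprime (coprime? (toℕ j) N)))
                 (m^n>0 x {{x≢0}} #units) U≡x^#units*U
    where
    x≢0 : NonZero x
    x≢0 = ≢-nonZero λ { refl → Coprimality.¬0-coprimeTo-2+ {{n>1⇒nonTrivial 1<N}} x⊥N }

euler : ∀ {N x} .{{_ : NonZero N}} → 1 < N → Coprime x N → x ^ φ N % N ≡ 1
euler {N} {x} 1<N x⊥N = begin
  x ^ φ N % N     ≡⟨ cong (λ e → x ^ e % N) (φ≡sumBelow-coprime 1<N) ⟩
  x ^ #units % N  ≡⟨ x^#units≡1 ⟩
  1 % N           ≡⟨ m<n⇒m%n≡m 1<N ⟩
  1               ∎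
  where
  open ≡-Reasoning
  open UnitProduct 1<N x⊥N using (#units; x^#units≡1)

euler-∣ : ∀ {N x n} .{{_ : NonZero N}} → 1 < N → Coprime x N → φ N ∣ n → x ^ n % N ≡ 1
euler-∣ {N} {x} {n} 1<N x⊥N (divides q n≡qφ) = begin
  x ^ n % N            ≡⟨ cong (λ e → x ^ e % N) (trans n≡qφ (*-comm q (φ N))) ⟩
  x ^ (φ N * q) % N    ≡⟨ cong (_% N) (^-*-assoc x (φ N) q) ⟨
  (x ^ φ N) ^ q % N    ≡⟨ ^-cong-mod q (trans (euler 1<N x⊥N) (sym 1%N≡1)) ⟩
  1 ^ q % N            ≡⟨ cong (_% N) (^-zeroˡ q) ⟩
  1 % N                ≡⟨ 1%N≡1 ⟩
  1                    ∎
  where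
  open ≡-Reasoning
  1%N≡1 : 1 % N ≡ 1
  1%N≡1 = m<n⇒m%n≡m 1<N

-- Descent

HasSolution-* : ∀ {m n t c} → 0 < c → HasSolution m n t → HasSolution m n (t * c ^ n)
HasSolution-* {m} {n} {t} {c} c>0 (x , x>0 , Σx^n≡t) =
  (λ i → x i * c) , (λ i → *-mono-≤ (x>0 i) c>0) , (begin
    sumFin m (λ i → (x i * c) ^ n)     ≡⟨ sumFin-cong m (λ i → ^-distribʳ-* (x i) c n) ⟩
    sumFin m (λ i → x i ^ n * c ^ n)   ≡⟨ sumFin-*ʳ m (λ i → x i ^ n) (c ^ n) ⟩
    sumFin m (λ i → x i ^ n) * c ^ n   ≡⟨ cong (_* c ^ n) Σx^n≡t ⟩
    t * c ^ n                          ∎)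
  where open ≡-Reasoning

HasSolution-/ : ∀ {m n t q} .{{_ : NonZero q}} (x : Fin m → ℕ) → (∀ i → 0 < x i) → (∀ i → q ∣ x i) →
                sumFin m (λ i → x i ^ n) ≡ t * q ^ n → HasSolution m n t
HasSolution-/ {m} {n} {t} {q} x x>0 q∣x Σx^n≡tqⁿ =
  y , y>0 , *-cancelʳ-≡ _ _ (q ^ n) {{m^n≢0 q n}} (begin
    sumFin m (λ i → y i ^ n) * q ^ n   ≡⟨ sumFin-*ʳ m (λ i → y i ^ n) (q ^ n) ⟨
    sumFin m (λ i → y i ^ n * q ^ n)   ≡⟨ sumFin-cong m (λ i → trans (cong (_^ n) (x≡yq i)) (^-distribʳ-* (y i) q n)) ⟨
    sumFin m (λ i → x i ^ n)           ≡⟨ Σx^n≡tqⁿ ⟩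
    t * q ^ n                          ∎)
  where
  open ≡-Reasoning
  y : Fin m → ℕ
  y i = _∣_.quotient (q∣x i)
  x≡yq : ∀ i → x i ≡ y i * q
  x≡yq i = _∣_.equality (q∣x i)
  y>0 : ∀ i → 0 < y i
  y>0 i = >-nonZero⁻¹ (y i) {{quotient≢0 (q∣x i) {{>-nonZero (x>0 i)}}}}

record Descends (m n c : ℕ) : Set where
  constructor descends
  field descend : ∀ t → HasSolution m n (t * c ^ n) → HasSolution m n t

open Descends

descends-1 : ∀ {m n} → Descends m n 1
descends-1 {m} {n} = descends λ t → subst (HasSolution m n) (trans (cong (t *_) (^-zeroˡ n)) (*-identityʳ t))

descends-* : ∀ {m n c d} → Descends m n c → Descends m n d → Descends m n (c * d)
descends-* {m} {n} {c} {d} ↓c ↓d = descends λ t →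
  descend ↓d t ∘ descend ↓c (t * d ^ n) ∘ subst (HasSolution m n) (t[cd]ⁿ≡tdⁿcⁿ t)
  where
  open ≡-Reasoning
  t[cd]ⁿ≡tdⁿcⁿ : ∀ t → t * (c * d) ^ n ≡ t * d ^ n * c ^ n
  t[cd]ⁿ≡tdⁿcⁿ t = begin
    t * (c * d) ^ n      ≡⟨ cong (t *_) (^-distribʳ-* c d n) ⟩
    t * (c ^ n * d ^ n)  ≡⟨ cong (t *_) (*-comm (c ^ n) (d ^ n)) ⟩
    t * (d ^ n * c ^ n)  ≡⟨ *-assoc t (d ^ n) (c ^ n) ⟨
    t * d ^ n * c ^ n    ∎

descends-^ : ∀ {m n c} → Descends m n c → ∀ e → Descends m n (c ^ e)
descends-^ ↓c zero    = descends-1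
descends-^ ↓c (suc e) = descends-* ↓c (descends-^ ↓c e)

descends-prodFin : ∀ {m n} l {f : Fin l → ℕ} → (∀ i → Descends m n (f i)) → Descends m n (prodFin l f)
descends-prodFin zero    ↓f = descends-1
descends-prodFin (suc l) ↓f = descends-* (↓f Fin.zero) (descends-prodFin l (↓f ∘ Fin.suc))

^-%-primePower : ∀ {p k n} x .{{_ : NonZero (p ^ k)}} → Prime p → 1 < p ^ k → k ≤ n → φ (p ^ k) ∣ n →
                 x ^ n % p ^ k ≡ indicator (¬? (p ∣? x))
^-%-primePower {p} {k} {n} x p-prime 1<pᵏ k≤n φ∣n with p ∣? x
... | yes p∣x = n∣m⇒m%n≡0 _ _ (∣-trans (^-monoʳ-∣ p k≤n) (^-monoˡ-∣ n p∣x))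
... | no  p∤x = euler-∣ 1<pᵏ (coprime-^ʳ k (¬∣⇒coprime p-prime p∤x)) φ∣n

φ-divisor-∣-solution : ∀ {n m p k t} → 0 < n → Prime p → IsφDivisorExp n p k → m < p ^ k →
                       (x : Fin m → ℕ) → sumFin m (λ i → x i ^ n) ≡ t * p ^ n → ∀ i → p ∣ x i
φ-divisor-∣-solution {n} {m} {p} {k} {t} n>0 p-prime (_ , pᵏ≥3 , φ∣n) m<pᵏ x Σx^n≡tpⁿ i =
  decidable-stable (p ∣? x i) (sumFin-indicator≡0 m p∤x? #p∤x≡0 i)
  where
  open ≡-Reasoning
  instance
    pᵏ≢0 : NonZero (p ^ k)
    pᵏ≢0 = m^n≢0 p k {{prime⇒nonZero p-prime}}
  1<pᵏ : 1 < p ^ k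
  1<pᵏ = ≤-trans (s≤s (s≤s z≤n)) pᵏ≥3
  k≤n : k ≤ n
  k≤n = ≤-trans (k≤φ[p^k] p-prime k) (∣⇒≤ {{>-nonZero n>0}} φ∣n)
  p∤x? : ∀ i → Dec (¬ p ∣ x i)
  p∤x? i = ¬? (p ∣? x i)
  residue : ∀ i → x i ^ n % p ^ k ≡ indicator (p∤x? i) % p ^ k
  residue i = trans (^-%-primePower (x i) p-prime 1<pᵏ k≤n φ∣n)
                    (sym (m<n⇒m%n≡m (≤-<-trans (indicator≤1 (p∤x? i)) 1<pᵏ)))
  #p∤x : ℕ
  #p∤x = sumFin m (λ i → indicator (p∤x? i))
  #p∤x≡0 : #p∤x ≡ 0
  #p∤x≡0 = begin
    #p∤x                              ≡⟨ m<n⇒m%n≡m (≤-<-trans (sumFin-indicator≤ m p∤x?) m<pᵏ) ⟨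
    #p∤x % p ^ k                      ≡⟨ sumFin-cong-mod m residue ⟨
    sumFin m (λ i → x i ^ n) % p ^ k  ≡⟨ cong (_% p ^ k) Σx^n≡tpⁿ ⟩
    t * p ^ n % p ^ k                 ≡⟨ n∣m⇒m%n≡0 _ _ (∣n⇒∣m*n t (^-monoʳ-∣ p k≤n)) ⟩
    0                                 ∎

φ-divisor-descends : ∀ {n m p k} → 0 < n → Prime p → IsφDivisorExp n p k → m < p ^ k → Descends m n p
φ-divisor-descends {n} n>0 p-prime φ-divisor m<pᵏ = descends λ where
  t (x , x>0 , Σx^n≡tpⁿ) → HasSolution-/ {n = n} {{prime⇒nonZero p-prime}} x x>0
                             (φ-divisor-∣-solution {t = t} n>0 p-prime φ-divisor m<pᵏ x Σx^n≡tpⁿ) Σx^n≡tpⁿ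

theorem10 : (n : ℕ) → 2 ≤ n → 2 ∣ n →
    (l : ℕ) → (p k e : Fin l → ℕ) → Injective _≡_ _≡_ p →
    (∀ i → IsφDivisorOfDegree n (p i) (k i)) →
    (m : ℕ) → 2 ≤ m → (∀ i → m ≤ p i ^ k i ∸ 1) →
    (∀ i → 1 ≤ e i) →
    (b : ℕ) →
    (¬ HasSolution m n (b * prodFin l (λ i → p i ^ e i) ^ n)) ⇔ (¬ HasSolution m n b)
theorem10 n 2≤n _ l p k e _ degree m _ m≤pᵏ∸1 _ b = mk⇔
  (λ ¬sol[bcⁿ] sol[b] → ¬sol[bcⁿ] (HasSolution-* {n = n} c>0 sol[b]))
  (λ ¬sol[b] sol[bcⁿ] → ¬sol[b] (descend (descends-prodFin l (λ i → descends-^ (p-descends i) (e i))) b sol[bcⁿ]))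
  where
  c>0 : 0 < prodFin l (λ i → p i ^ e i)
  c>0 = prodFin-positive l (λ i → m^n>0 (p i) {{prime⇒nonZero (proj₁ (degree i))}} (e i))
  p-descends : ∀ i → Descends m n (p i)
  p-descends i with degree i
  ... | pᵢ-prime , φ-divisor@(_ , pᵏ≥3 , _) , _ =
    φ-divisor-descends (≤-trans (s≤s z≤n) 2≤n) pᵢ-prime φ-divisor
      (≤-<-trans (m≤pᵏ∸1 i) (∸-monoʳ-< z<s (≤-trans (s≤s z≤n) pᵏ≥3)))
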